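{- Let $G$ be a finite simple graph of order $n$ with minimum degree $\delta\geq 2$ and maximum degree $\Delta$. Then $$\left\lceil\frac{2n}{1+\Delta}\right\rceil\leq s\ell_{\times2}(G)\leq \left\lceil\frac{2n}{1+\delta}\right\rceil.$$
   Context: For a graph $G$ of order $n$ with non-increasing degree sequence $d_1\geq\cdots\geq d_n$, $e$ end-vertices (vertices of degree one) and $p$ penultimate vertices (vertices adjacent to an end-vertex), the double Slater number is $s\ell_{\times2}(G)=\min\{t\mid t+d_1+\cdots+d_{t-e}\geq 2n-p\}$. When $\delta(G)\geq 2$ we have $e=p=0$, so $s\ell_{\times2}(G)=\min\{t\mid t+d_1+\cdots+d_t\geq 2n\}$. -}

module Defs where

open import Data.Bool using (Bool; true; false; if_then_else_; _∧_)
open import Data.Nat using (ℕ; zero; suc; _+_; _*_; _∸_; _≤ᵇ_; _≡ᵇ_; _⊔_; _⊓_)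
open import Data.Nat.DivMod using (_/_)
open import Data.Fin using (Fin)
open import Data.List using (List; []; _∷_; map; take; foldr; allFin)
open import Data.Nat.ListAction using (sum)
open import Data.Bool.ListAction using (any)
open import Relation.Binary.PropositionalEquality using (_≡_)

record SimpleGraph (n : ℕ) : Set where
  field
    adj    : Fin n → Fin n → Bool
    sym    : ∀ i j → adj i j ≡ adj j i
    irrefl : ∀ i → adj i i ≡ false
open SimpleGraph public

deg : ∀ {n} → SimpleGraph n → Fin n → ℕ
deg {n} G v = sum (map (λ u → if adj G v u then 1 else 0) (allFin n))

degrees : ∀ {n} → SimpleGraph n → List ℕ
degrees {n} G = map (deg G) (allFin n)

maxDeg : ∀ {n} → SimpleGraph n → ℕ
maxDeg G = foldr _⊔_ 0 (degrees G)

minDeg : ∀ {n} → SimpleGraph n → ℕ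
minDeg {zero}  G = 0
minDeg {suc n} G = foldr _⊓_ (suc n) (degrees G)

insertDesc : ℕ → List ℕ → List ℕ
insertDesc x [] = x ∷ []
insertDesc x (y ∷ ys) = if y ≤ᵇ x then x ∷ y ∷ ys else y ∷ insertDesc x ys

sortDesc : List ℕ → List ℕ
sortDesc = foldr insertDesc []

degSeq : ∀ {n} → SimpleGraph n → List ℕ
degSeq G = sortDesc (degrees G)

sumTop : ∀ {n} → SimpleGraph n → ℕ → ℕ
sumTop G k = sum (take k (degSeq G))

count : ∀ {n} → (Fin n → Bool) → ℕ
count {n} P = sum (map (λ v → if P v then 1 else 0) (allFin n))

isEnd : ∀ {n} → SimpleGraph n → Fin n → Bool
isEnd G v = deg G v ≡ᵇ 1

isPenultimate : ∀ {n} → SimpleGraph n → Fin n → Bool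
isPenultimate {n} G v = any (λ u → adj G v u ∧ isEnd G u) (allFin n)

numEnd : ∀ {n} → SimpleGraph n → ℕ
numEnd G = count (isEnd G)

numPen : ∀ {n} → SimpleGraph n → ℕ
numPen G = count (isPenultimate G)

slaterCond : ∀ {n} → SimpleGraph n → ℕ → Bool
slaterCond {n} G t = (2 * n ∸ numPen G) ≤ᵇ (t + sumTop G (t ∸ numEnd G))

leastFrom : (ℕ → Bool) → ℕ → ℕ → ℕ
leastFrom P i zero = i
leastFrom P i (suc fuel) = if P i then i else leastFrom P (suc i) fuel

-- double Slater number  sℓ×2(G) = min { t | t + d₁ + ⋯ + d_{t-e} ≥ 2n - p }.
-- The search range [0, 2n] suffices, since t = 2n always satisfies the condition.
doubleSlater : ∀ {n} → SimpleGraph n → ℕ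
doubleSlater {n} G = leastFrom (slaterCond G) 0 (2 * n)

-- ⌈ a / (1 + b) ⌉
ceilDivSuc : ℕ → ℕ → ℕ
ceilDivSuc a b = (a + b) / suc b

-- Without end-vertices the defining condition reads t + d₁ + ⋯ + d_t ≥ 2n. For t ≤ n its
-- left side lies between t(1 + δ) and t(1 + Δ): hence every admissible t is at least
-- ⌈2n/(1 + Δ)⌉, while t = ⌈2n/(1 + δ)⌉ is admissible, and δ ≥ 1 gives t ≤ n.
module Submission where

open import Defs
open import Data.Nat using (ℕ; _*_; _≤_)
open import Data.Fin using (Fin)
open import Data.Product using (_×_; _,_)

open import Data.Bool using (Bool; true; false; T; _∧_; if_then_else_)
open import Data.Bool.ListAction using (any)
open import Data.Bool.Properties using (∧-zeroʳ)
open import Data.List using ([]; _∷_; map; take; foldr; allFin; length)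
open import Data.List.Properties using (length-map; length-tabulate)
open import Data.List.Relation.Binary.Permutation.Propositional
  using (_↭_; refl; prep; swap; trans; ↭-sym)
open import Data.List.Relation.Binary.Permutation.Propositional.Properties
  using (↭-length; All-resp-↭)
open import Data.List.Relation.Unary.All as All using (All; []; _∷_; universal)
open import Data.List.Relation.Unary.All.Properties using (map⁺)
open import Data.Nat using (zero; suc; _+_; _≤ᵇ_; _≡ᵇ_; _⊔_; _⊓_; z≤n; s≤s; s≤s⁻¹)
open import Data.Nat.DivMod using (_%_; m≡m%n+[m/n]*n; m%n<n; m<n*o⇒m/o<n)
open import Data.Nat.ListAction using (sum)
open import Data.Nat.Properties
open import Function using (_⇔_; mk⇔; Equivalence)
open import Relation.Binary.PropositionalEquality
  using (_≡_; _≢_; cong; subst; module ≡-Reasoning)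
  renaming (refl to ≡-refl; sym to ≡-sym; trans to ≡-trans)

false-true⇒≢ : ∀ (P : ℕ → Bool) {i k} → P i ≡ false → T (P k) → i ≢ k
false-true⇒≢ P Pi Pk ≡-refl = subst T Pi Pk

leastFrom-minimal : ∀ (P : ℕ → Bool) i f {k} → T (P k) → i ≤ k → leastFrom P i f ≤ k
leastFrom-minimal P i zero    Pk i≤k = i≤k
leastFrom-minimal P i (suc f) Pk i≤k with P i in Pi
... | true  = i≤k
... | false = leastFrom-minimal P (suc i) f Pk (≤∧≢⇒< i≤k (false-true⇒≢ P Pi Pk))

leastFrom-satisfies : ∀ (P : ℕ → Bool) i f {k} → T (P k) → i ≤ k → k ≤ i + f →
                      T (P (leastFrom P i f))
leastFrom-satisfies P i zero Pk i≤k k≤i+0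
  rewrite ≤-antisym (≤-trans k≤i+0 (≤-reflexive (+-identityʳ i))) i≤k = Pk
leastFrom-satisfies P i (suc f) Pk i≤k k≤i+f with P i in Pi
... | true  = subst T (≡-sym Pi) _
... | false = leastFrom-satisfies P (suc i) f Pk (≤∧≢⇒< i≤k (false-true⇒≢ P Pi Pk))
                (≤-trans k≤i+f (≤-reflexive (+-suc i f)))

insertDesc-↭ : ∀ x ys → insertDesc x ys ↭ x ∷ ys
insertDesc-↭ x []       = refl
insertDesc-↭ x (y ∷ ys) with y ≤ᵇ x
... | true  = refl
... | false = trans (prep y (insertDesc-↭ x ys)) (swap y x refl)

sortDesc-↭ : ∀ xs → sortDesc xs ↭ xs
sortDesc-↭ []       = refl
sortDesc-↭ (x ∷ xs) = trans (insertDesc-↭ x (sortDesc xs)) (prep x (sortDesc-↭ xs))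

sum-take-≤ : ∀ {D} k xs → All (_≤ D) xs → sum (take k xs) ≤ k * D
sum-take-≤ zero    xs       _          = z≤n
sum-take-≤ (suc k) []       _          = z≤n
sum-take-≤ (suc k) (x ∷ xs) (x≤D ∷ ≤D) = +-mono-≤ x≤D (sum-take-≤ k xs ≤D)

sum-take-≥ : ∀ {d} k xs → All (d ≤_) xs → k ≤ length xs → k * d ≤ sum (take k xs)
sum-take-≥ zero    xs       _          _         = z≤n
sum-take-≥ (suc k) (x ∷ xs) (d≤x ∷ d≤) (s≤s k≤∣xs∣) = +-mono-≤ d≤x (sum-take-≥ k xs d≤ k≤∣xs∣)

foldr-⊔-upper : ∀ xs → All (_≤ foldr _⊔_ 0 xs) xs
foldr-⊔-upper []       = []
foldr-⊔-upper (x ∷ xs) = m≤m⊔n x _ ∷ All.map (λ p → ≤-trans p (m≤n⊔m x _)) (foldr-⊔-upper xs)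

foldr-⊓-lower : ∀ b xs → All (foldr _⊓_ b xs ≤_) xs
foldr-⊓-lower b []       = []
foldr-⊓-lower b (x ∷ xs) = m⊓n≤m x _ ∷ All.map (≤-trans (m⊓n≤n x _)) (foldr-⊓-lower b xs)

foldr-⊓-greatest : ∀ {c} b xs → c ≤ b → All (c ≤_) xs → c ≤ foldr _⊓_ b xs
foldr-⊓-greatest b []       c≤b []          = c≤b
foldr-⊓-greatest b (x ∷ xs) c≤b (c≤x ∷ c≤) = ⊓-glb c≤x (foldr-⊓-greatest b xs c≤b c≤)

ceilDivSuc-least : ∀ a b {c} → a ≤ c * suc b → ceilDivSuc a b ≤ c
ceilDivSuc-least a b {c} a≤c[1+b] = s≤s⁻¹ (m<n*o⇒m/o<n (begin-strict
  a + b             ≤⟨ +-monoˡ-≤ b a≤c[1+b] ⟩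
  c * suc b + b     <⟨ +-monoʳ-< (c * suc b) (n<1+n b) ⟩
  c * suc b + suc b ≡⟨ +-comm (c * suc b) (suc b) ⟩
  suc c * suc b     ∎))
  where open ≤-Reasoning

ceilDivSuc-cover : ∀ a b → a ≤ ceilDivSuc a b * suc b
ceilDivSuc-cover a b = +-cancelʳ-≤ b a (q * suc b) (begin
  a + b                       ≡⟨ m≡m%n+[m/n]*n (a + b) (suc b) ⟩
  (a + b) % suc b + q * suc b ≤⟨ +-monoˡ-≤ (q * suc b) (s≤s⁻¹ (m%n<n (a + b) (suc b))) ⟩
  b + q * suc b               ≡⟨ +-comm b (q * suc b) ⟩
  q * suc b + b               ∎)
  where
  open ≤-Reasoning
  q : ℕ
  q = ceilDivSuc a b

sum-map-zero : ∀ {A : Set} (f : A → ℕ) xs → (∀ x → f x ≡ 0) → sum (map f xs) ≡ 0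
sum-map-zero f []       f≡0 = ≡-refl
sum-map-zero f (x ∷ xs) f≡0 rewrite f≡0 x = sum-map-zero f xs f≡0

count-none : ∀ {n} (P : Fin n → Bool) → (∀ v → P v ≡ false) → count P ≡ 0
count-none {n} P ¬P = sum-map-zero _ (allFin n) (λ v → cong (λ b → if b then 1 else 0) (¬P v))

any-none : ∀ {A : Set} (p : A → Bool) xs → (∀ x → p x ≡ false) → any p xs ≡ false
any-none p []       ¬p = ≡-refl
any-none p (x ∷ xs) ¬p rewrite ¬p x = any-none p xs ¬p

minDeg-lower : ∀ {n} (G : SimpleGraph n) → All (minDeg G ≤_) (degrees G)
minDeg-lower {zero}  G = []
minDeg-lower {suc n} G = foldr-⊓-lower (suc n) (degrees G)

module _ {n} (G : SimpleGraph n) where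

  maxDeg-upper : All (_≤ maxDeg G) (degrees G)
  maxDeg-upper = foldr-⊔-upper (degrees G)

  degSeq-all : ∀ {P : ℕ → Set} → All P (degrees G) → All P (degSeq G)
  degSeq-all = All-resp-↭ (↭-sym (sortDesc-↭ (degrees G)))

  length-degSeq : length (degSeq G) ≡ n
  length-degSeq = begin
    length (degSeq G)  ≡⟨ ↭-length (sortDesc-↭ (degrees G)) ⟩
    length (degrees G) ≡⟨ length-map (deg G) (allFin n) ⟩
    length (allFin n)  ≡⟨ length-tabulate (λ v → v) ⟩
    n                  ∎
    where open ≡-Reasoning

  sumTop-≤ : ∀ t → sumTop G t ≤ t * maxDeg G
  sumTop-≤ t = sum-take-≤ t (degSeq G) (degSeq-all maxDeg-upper)

  sumTop-≥ : ∀ {t} → t ≤ n → t * minDeg G ≤ sumTop G t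
  sumTop-≥ {t} t≤n = sum-take-≥ t (degSeq G) (degSeq-all (minDeg-lower G))
                       (subst (t ≤_) (≡-sym length-degSeq) t≤n)

  isEnd-false : ∀ {v} → 2 ≤ deg G v → isEnd G v ≡ false
  isEnd-false = ≥2⇒≢ᵇ1
    where
    ≥2⇒≢ᵇ1 : ∀ {d} → 2 ≤ d → (d ≡ᵇ 1) ≡ false
    ≥2⇒≢ᵇ1 (s≤s (s≤s _)) = ≡-refl

  module _ (noEnd : ∀ v → isEnd G v ≡ false) where

    numEnd≡0 : numEnd G ≡ 0
    numEnd≡0 = count-none (isEnd G) noEnd

    numPen≡0 : numPen G ≡ 0
    numPen≡0 = count-none (isPenultimate G) λ v →
      any-none _ (allFin n) (λ u → ≡-trans (cong (adj G v u ∧_) (noEnd u)) (∧-zeroʳ (adj G v u)))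

    slaterCond⇔ : ∀ t → T (slaterCond G t) ⇔ 2 * n ≤ t + sumTop G t
    slaterCond⇔ t rewrite numEnd≡0 | numPen≡0 = mk⇔ (≤ᵇ⇒≤ _ _) ≤⇒≤ᵇ

ceilDivSuc-minDeg-≤-order : ∀ {n} (G : SimpleGraph n) → (∀ v → 1 ≤ deg G v) →
  ceilDivSuc (2 * n) (minDeg G) ≤ n
ceilDivSuc-minDeg-≤-order {zero}  G _   = z≤n
ceilDivSuc-minDeg-≤-order {suc m} G 1≤d = ceilDivSuc-least (2 * n) δ (begin
  2 * n     ≡⟨ *-comm 2 n ⟩
  n * 2     ≤⟨ *-monoʳ-≤ n (s≤s 1≤δ) ⟩
  n * suc δ ∎)
  where
  open ≤-Reasoning
  n δ : ℕ
  n = suc m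
  δ = minDeg G
  1≤δ : 1 ≤ δ
  1≤δ = foldr-⊓-greatest n (degrees G) (s≤s z≤n) (map⁺ (universal 1≤d (allFin n)))

proposition1 : (n : ℕ) (G : SimpleGraph n) →
    (∀ v → 2 ≤ deg G v) →
    (ceilDivSuc (2 * n) (maxDeg G) ≤ doubleSlater G) × (doubleSlater G ≤ ceilDivSuc (2 * n) (minDeg G))
proposition1 n G 2≤d = lower , upper
  where
  open ≤-Reasoning
  open Equivalence
  Δ δ r k : ℕ
  Δ = maxDeg G
  δ = minDeg G
  r = doubleSlater G
  k = ceilDivSuc (2 * n) δ

  slater⇔ : ∀ t → T (slaterCond G t) ⇔ 2 * n ≤ t + sumTop G t
  slater⇔ = slaterCond⇔ G (λ v → isEnd-false G (2≤d v))

  k≤n : k ≤ n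
  k≤n = ceilDivSuc-minDeg-≤-order G (λ v → ≤-trans (n≤1+n 1) (2≤d v))

  k-satisfies : T (slaterCond G k)
  k-satisfies = from (slater⇔ k) (begin
    2 * n          ≤⟨ ceilDivSuc-cover (2 * n) δ ⟩
    k * suc δ      ≡⟨ *-suc k δ ⟩
    k + k * δ      ≤⟨ +-monoʳ-≤ k (sumTop-≥ G k≤n) ⟩
    k + sumTop G k ∎)

  r-satisfies : T (slaterCond G r)
  r-satisfies = leastFrom-satisfies (slaterCond G) 0 (2 * n) k-satisfies z≤n (≤-trans k≤n (m≤n*m n 2))

  lower : ceilDivSuc (2 * n) Δ ≤ r
  lower = ceilDivSuc-least (2 * n) Δ (begin
    2 * n          ≤⟨ to (slater⇔ r) r-satisfies ⟩
    r + sumTop G r ≤⟨ +-monoʳ-≤ r (sumTop-≤ G r) ⟩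
    r + r * Δ      ≡⟨ *-suc r Δ ⟨
    r * suc Δ      ∎)

  upper : r ≤ k
  upper = leastFrom-minimal (slaterCond G) 0 (2 * n) k-satisfies z≤n
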